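{- Let $k\ge 2$ be an integer, let $H=(V,\mathcal{E})$ be a hypergraph on $n$ vertices which is hereditarily $k$-colorable, and set $\lambda=\frac{k}{k-1}$. Let $\mathcal{L}=\{L_v\}_{v\in V}$ be a family of finite sets of positive integers such that $|L_v|>\log_\lambda n$ for every $v\in V$. Then $H$ admits a unique-maximum coloring from $\mathcal{L}$.
   Context: For $V'\subseteq V$, $H[V']=(V',\{S\cap V' : S\in\mathcal{E}\})$. A coloring is proper if every hyperedge with at least two vertices is non-monochromatic. $H$ is hereditarily $k$-colorable if every $H[V']$ ($V'\subseteq V$) admits a proper coloring with at most $k$ colors. A coloring $C\colon V\to\mathbb{Z}_{>0}$ is a unique-maximum coloring if in every hyperedge the maximum color appears on exactly one vertex; it is from $\mathcal{L}$ if $C(v)\in L_v$ for all $v$. -}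

module Defs where

open import Data.Nat using (ℕ; _≤_; _<_; _*_; _^_; _∸_)
open import Data.Fin using (Fin)
open import Data.Fin.Subset using (Subset; _∈_; _∩_; ∣_∣; Nonempty)
open import Data.List using (List; length)
open import Data.List.Membership.Propositional renaming (_∈_ to _∈ˡ_)
open import Data.List.Relation.Unary.All using (All)
open import Data.List.Relation.Unary.Unique.Propositional using (Unique)
open import Data.Product using (Σ; ∃; _×_)
open import Relation.Binary.PropositionalEquality using (_≡_; _≢_)
open import Level using (Level; suc)

record Hypergraph (n : ℕ) : Set₁ where
  field
    Edge     : Subset n → Set
    nonempty : ∀ S → Edge S → Nonempty S
open Hypergraph public

-- The induced subhypergraph H[V'] has hyperedges S ∩ V' (S ∈ E).
ProperOn : ∀ {n k} → Hypergraph n → Subset n → (Fin n → Fin k) → Set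
ProperOn H V' c =
  ∀ S → Edge H S → 2 ≤ ∣ S ∩ V' ∣ →
  Σ (Fin _) λ u → Σ (Fin _) λ w → u ∈ (S ∩ V') × w ∈ (S ∩ V') × c u ≢ c w

HereditarilyColorable : ∀ {n} → ℕ → Hypergraph n → Set
HereditarilyColorable {n} k H =
  ∀ (V' : Subset n) → ∃ λ (c : Fin n → Fin k) → ProperOn H V' c

UniqueMax : ∀ {n} → Hypergraph n → (Fin n → ℕ) → Set
UniqueMax H C =
  ∀ S → Edge H S →
  Σ (Fin _) λ v → v ∈ S × (∀ u → u ∈ S → u ≢ v → C u < C v)

-- a family of finite sets of positive integers, as duplicate-free lists
ListAssignment : ℕ → Set
ListAssignment n = Fin n → List ℕ

WellFormedLists : ∀ {n} → ListAssignment n → Set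
WellFormedLists L = ∀ v → Unique (L v) × All (λ c → 0 < c) (L v)

FromLists : ∀ {n} → ListAssignment n → (Fin n → ℕ) → Set
FromLists L C = ∀ v → C v ∈ˡ L v

-- m > log_λ n with λ = k/(k-1), n ≥ 1, k ≥ 2, i.e. λ^m > n,
-- i.e. n * (k-1)^m < k^m  (cleared of denominators, all in ℕ).
GtLog : (k n m : ℕ) → Set
GtLog k n m = n * (k ∸ 1) ^ m < k ^ m

module Submission where

open import Defs
open import Data.Nat using (ℕ; _≤_; _<_)
open import Data.Fin using (Fin)
open import Data.List using (length)
open import Data.Product using (∃; _×_)

open import Data.Bool using (Bool; true; false; T; _∧_; not; if_then_else_)
open import Data.Bool.Properties using (T?)

open import Data.Fin as Fin using (zero; suc)
open import Data.Fin.Properties using (any?)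
open import Data.Fin.Subset using (Subset; _∈_; _∩_; ⁅_⁆; ∣_∣)
open import Data.Fin.Subset.Properties
  using (_∈?_; x∈p∩q⁺; x∈p∩q⁻; x∈⁅y⁆⇒x≡y; ∣⁅x⁆∣≡1; p⊂q⇒∣p∣<∣q∣)
open import Data.List using (List; []; _∷_; allFin)
open import Data.List.Extrema.Nat using (argmax; max; f[xs]≤f[argmax]; xs≤max)
open import Data.List.Membership.Propositional renaming (_∈_ to _∈ˡ_; _∉_ to _∉ˡ_)
open import Data.List.Membership.DecPropositional Data.Nat._≟_
  using () renaming (_∈?_ to _∈ˡ?_)
open import Data.List.Membership.Propositional.Properties using (∈-allFin)
open import Data.List.Relation.Unary.All as All using (All; _∷_)
open import Data.List.Relation.Unary.AllPairs using (_∷_)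
open import Data.List.Relation.Unary.Any using (here; there)
open import Data.List.Relation.Unary.Unique.Propositional using (Unique)
open import Data.Nat using (zero; suc; _+_; _*_; _∸_; _^_; z≤n; s≤s; NonZero)
open import Data.Nat.Properties
open import Data.Nat.Tactic.RingSolver using (solve-∀)
open import Algebra.Properties.Semiring.Sum +-*-semiring
  using (sum; ∑-comm; ∑-distrib-+; sum-replicate-zero; *-distribˡ-sum; sum-cong-≗)
open import Data.Product using (Σ; _,_; proj₁; proj₂)
open import Data.Vec using (tabulate)
open import Data.Vec.Properties using ([]=⇒lookup; lookup⇒[]=; lookup∘tabulate)
open import Function using (_∘_)
open import Relation.Binary.PropositionalEquality
open import Relation.Nullary using (Dec; yes; no; does; ¬_; contradiction)
open import Relation.Nullary.Decidable using (decidable-stable; _×-dec_)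

-- Colors are handed out in increasing order. Put K = k and d = k − 1, and give an
-- uncolored vertex that still has c admissible colors ahead of it the potential
-- (d/K)^c (scaled by K^M to stay in ℕ); the hypothesis |L v| > log_λ n says that the
-- total potential starts below 1. In round α, properly K-color the uncolored
-- vertices whose list contains α and give α to the heaviest color class I. The other
-- vertices holding α lose an admissible color, so their potential grows by K/d, but I
-- carries at least a 1/K share of the potential of all of them, so the total never
-- increases. Once every color has been passed an uncolored vertex would have
-- potential 1, so none is left. An edge that still meets uncolored vertices after
-- round α receives its maximum later, above α; an edge whose remaining vertices all
-- receive α contains only one of them, because I is independent.

∑-mono-≤ : ∀ {m} {f g : Fin m → ℕ} → (∀ i → f i ≤ g i) → sum f ≤ sum g
∑-mono-≤ {zero}  f≤g = z≤n
∑-mono-≤ {suc m} f≤g = +-mono-≤ (f≤g zero) (∑-mono-≤ (f≤g ∘ suc))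

∑-mono-< : ∀ {m} {f g : Fin (suc m) → ℕ} → (∀ i → f i < g i) → sum f < sum g
∑-mono-< f<g = +-mono-<-≤ (f<g zero) (∑-mono-≤ (<⇒≤ ∘ f<g ∘ suc))

∑-const : ∀ m x → sum {m} (λ _ → x) ≡ m * x
∑-const zero    x = refl
∑-const (suc m) x = cong (x +_) (∑-const m x)

≤-∑ : ∀ {m} (f : Fin m → ℕ) i → f i ≤ sum f
≤-∑ f zero    = m≤m+n _ _
≤-∑ f (suc i) = ≤-trans (≤-∑ (f ∘ suc) i) (m≤n+m _ _)

∑-*-+ : ∀ {m} a (f g : Fin m → ℕ) → sum (λ i → a * f i + g i) ≡ a * sum f + sum g
∑-*-+ a f g =
  trans (∑-distrib-+ (λ i → a * f i) g) (cong (_+ sum g) (sym (*-distribˡ-sum a f)))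

∀[m*f<X]⇒∑f<X : ∀ {m} (f : Fin m → ℕ) {X} → 0 < X → (∀ i → m * f i < X) → sum f < X
∀[m*f<X]⇒∑f<X {zero}  f 0<X _      = 0<X
∀[m*f<X]⇒∑f<X {suc m} f {X} _ m*f<X = *-cancelˡ-< (suc m) (sum f) X (begin-strict
  suc m * sum f              ≡⟨ *-distribˡ-sum (suc m) f ⟩
  sum (λ i → suc m * f i)    <⟨ ∑-mono-< m*f<X ⟩
  sum {suc m} (λ _ → X)      ≡⟨ ∑-const (suc m) X ⟩
  suc m * X                  ∎)
  where open ≤-Reasoning

infix 8 _when_

_when_ : ℕ → Bool → ℕ
x when true  = x
x when false = 0

when-true : ∀ {b} x → T b → x when b ≡ x
when-true {true} x _ = refl

∑-when-≟ : ∀ {k} (c : Fin k) b x → sum (λ i → x when (b ∧ does (c Fin.≟ i))) ≡ x when b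
∑-when-≟ {k} c false x = sum-replicate-zero k
∑-when-≟ {suc k} zero    true x = trans (cong (x +_) (sum-replicate-zero k)) (+-identityʳ x)
∑-when-≟ {suc k} (suc c) true x = ∑-when-≟ c true x

descend : ∀ {p} {P : ℕ → Set p} → (∀ t → P (suc t) → P t) → ∀ m → P m → P 0
descend step zero    P0 = P0
descend step (suc m) Pm = descend step m (step m Pm)

countAbove : ℕ → List ℕ → ℕ
countAbove t [] = 0
countAbove t (x ∷ xs) with t <? x
... | yes _ = suc (countAbove t xs)
... | no _  = countAbove t xs

countAbove≤length : ∀ t xs → countAbove t xs ≤ length xs
countAbove≤length t [] = z≤n
countAbove≤length t (x ∷ xs) with t <? x
... | yes _ = s≤s (countAbove≤length t xs)
... | no _  = m≤n⇒m≤1+n (countAbove≤length t xs)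

countAbove-all : ∀ t xs → All (t <_) xs → countAbove t xs ≡ length xs
countAbove-all t [] _ = refl
countAbove-all t (x ∷ xs) (t<x ∷ t<xs) with t <? x
... | yes _  = cong suc (countAbove-all t xs t<xs)
... | no t≮x = contradiction t<x t≮x

countAbove-none : ∀ t xs → All (_≤ t) xs → countAbove t xs ≡ 0
countAbove-none t [] _ = refl
countAbove-none t (x ∷ xs) (x≤t ∷ xs≤t) with t <? x
... | yes t<x = contradiction x≤t (<⇒≱ t<x)
... | no _    = countAbove-none t xs xs≤t

countAbove-∉ : ∀ t xs → suc t ∉ˡ xs → countAbove t xs ≡ countAbove (suc t) xs
countAbove-∉ t [] _ = refl
countAbove-∉ t (x ∷ xs) 1+t∉ with t <? x | suc t <? x
... | yes _   | yes _     = cong suc (countAbove-∉ t xs (1+t∉ ∘ there))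
... | yes t<x | no 1+t≮x  = contradiction (here (≤-antisym t<x (≮⇒≥ 1+t≮x))) 1+t∉
... | no t≮x  | yes 1+t<x = contradiction (<-trans (n<1+n t) 1+t<x) t≮x
... | no _    | no _      = countAbove-∉ t xs (1+t∉ ∘ there)

countAbove-∈ : ∀ t xs → Unique xs → suc t ∈ˡ xs →
  countAbove t xs ≡ suc (countAbove (suc t) xs)
countAbove-∈ t (x ∷ xs) (x∉xs ∷ _) (here refl) with t <? x | suc t <? x
... | yes _    | yes 1+t<1+t = contradiction 1+t<1+t (<-irrefl refl)
... | yes _    | no _        = cong suc (countAbove-∉ t xs (λ 1+t∈ → All.lookup x∉xs 1+t∈ refl))
... | no t≮1+t | _           = contradiction ≤-refl t≮1+t
countAbove-∈ t (x ∷ xs) (x∉xs ∷ unique) (there 1+t∈) with t <? x | suc t <? x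
... | yes _   | yes _     = cong suc (countAbove-∈ t xs unique 1+t∈)
... | yes t<x | no 1+t≮x  = contradiction (≤-antisym (≮⇒≥ 1+t≮x) t<x) (All.lookup x∉xs 1+t∈)
... | no t≮x  | yes 1+t<x = contradiction (<-trans (n<1+n t) 1+t<x) t≮x
... | no _    | no _      = countAbove-∈ t xs unique 1+t∈

module Potential (d M : ℕ) where

  -- (d / (d + 1))^c scaled by (d + 1)^M; all uses keep c ≤ M, so M ∸ c never truncates.
  weight : ℕ → ℕ
  weight c = d ^ c * suc d ^ (M ∸ c)

  d*weight≡K*weight-suc : ∀ c → suc c ≤ M → d * weight c ≡ suc d * weight (suc c)
  d*weight≡K*weight-suc c 1+c≤M = begin
    d * (d ^ c * suc d ^ (M ∸ c))
      ≡⟨ cong (λ e → d * (d ^ c * suc d ^ e)) M∸c≡1+M∸[1+c] ⟩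
    d * (d ^ c * (suc d * suc d ^ (M ∸ suc c)))
      ≡⟨ rearrange d (d ^ c) (suc d) (suc d ^ (M ∸ suc c)) ⟩
    suc d * (d * d ^ c * suc d ^ (M ∸ suc c)) ∎
    where
      open ≡-Reasoning
      M∸c≡1+M∸[1+c] : M ∸ c ≡ suc (M ∸ suc c)
      M∸c≡1+M∸[1+c] = +-∸-assoc 1 1+c≤M
      rearrange : ∀ a b e f → a * (b * (e * f)) ≡ e * (a * b * f)
      rearrange = solve-∀

  potential : ℕ → List ℕ → ℕ
  potential t xs = weight (countAbove t xs)

  potential-∉ : ∀ t xs → suc t ∉ˡ xs → potential (suc t) xs ≡ potential t xs
  potential-∉ t xs 1+t∉ = cong weight (sym (countAbove-∉ t xs 1+t∉))

  potential-∈ : ∀ t xs → Unique xs → length xs ≤ M → suc t ∈ˡ xs →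
    d * potential (suc t) xs ≡ suc d * potential t xs
  potential-∈ t xs unique short 1+t∈ rewrite countAbove-∈ t xs unique 1+t∈ =
    d*weight≡K*weight-suc (countAbove (suc t) xs)
      (≤-trans (≤-reflexive (sym (countAbove-∈ t xs unique 1+t∈)))
               (≤-trans (countAbove≤length t xs) short))

  potential-exhausted : ∀ t xs → All (_≤ t) xs → potential t xs ≡ suc d ^ M
  potential-exhausted t xs xs≤t rewrite countAbove-none t xs xs≤t = *-identityˡ (suc d ^ M)

  potential-initial : ∀ n xs → All (0 <_) xs → length xs ≤ M →
    n * d ^ length xs < suc d ^ length xs → n * potential 0 xs < suc d ^ M
  potential-initial n xs positive short n*dˡ<Kˡ rewrite countAbove-all 0 xs positive =
    begin-strict
      n * (d ^ l * suc d ^ (M ∸ l))   ≡⟨ *-assoc n (d ^ l) _ ⟨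
      n * d ^ l * suc d ^ (M ∸ l)     <⟨ *-monoˡ-< _ {{m^n≢0 (suc d) (M ∸ l)}} n*dˡ<Kˡ ⟩
      suc d ^ l * suc d ^ (M ∸ l)     ≡⟨ ^-distribˡ-+-* (suc d) l (M ∸ l) ⟨
      suc d ^ (l + (M ∸ l))           ≡⟨ cong (suc d ^_) (m+[n∸m]≡n short) ⟩
      suc d ^ M                       ∎
    where
      open ≤-Reasoning
      l = length xs

  when-accounting : ∀ (u l e : Bool) {x y} →
    (¬ T l → y ≡ x) → (T l → d * y ≡ suc d * x) →
    d * (y when (u ∧ not ((u ∧ l) ∧ e))) + suc d * (x when ((u ∧ l) ∧ e)) ≡
    d * (x when u) + x when (u ∧ l)
  when-accounting false _     _     _   _       rewrite *-zeroʳ d = refl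
  when-accounting true  false _     y≡x _       rewrite *-zeroʳ d | y≡x (λ ()) = refl
  when-accounting true  true  false {x} {y} _ d*y≡K*x
    rewrite *-zeroʳ d | d*y≡K*x _ = trans (+-identityʳ (x + d * x)) (+-comm x (d * x))
  when-accounting true  true  true  {x} _ _     rewrite *-zeroʳ d = +-comm x (d * x)

VertexSet : ℕ → Set
VertexSet n = Fin n → Bool

infixl 6 _∖_

_∖_ : ∀ {n} → VertexSet n → VertexSet n → VertexSet n
(U ∖ I) v = U v ∧ not (I v)

∖-intro : ∀ {u i} → T u → ¬ T i → T (u ∧ not i)
∖-intro {true} {false} _ _  = _
∖-intro {true} {true}  _ ¬i = ¬i _

∖-elim : ∀ {u i} → T (u ∧ not i) → T u × ¬ T i
∖-elim {true} {false} _ = _ , λ ()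

T-does⁻ : ∀ {a} {A : Set a} (a? : Dec A) → T (does a?) → A
T-does⁻ (yes a) _ = a

¬T-does⁻ : ∀ {a} {A : Set a} (a? : Dec A) → ¬ T (does a?) → ¬ A
¬T-does⁻ (yes _) ¬t = contradiction _ ¬t
¬T-does⁻ (no ¬a) _  = ¬a

∧-elim : ∀ {a b} → T (a ∧ b) → T a × T b
∧-elim {true} b = _ , b

∈-tabulate⁺ : ∀ {n} {f : VertexSet n} {u} → T (f u) → u ∈ tabulate f
∈-tabulate⁺ {f = f} {u} fu with f u in eq
... | true = lookup⇒[]= u (tabulate f) (trans (lookup∘tabulate f u) eq)

∈-tabulate⁻ : ∀ {n} {f : VertexSet n} {u} → u ∈ tabulate f → T (f u)
∈-tabulate⁻ {f = f} {u} u∈ rewrite sym (lookup∘tabulate f u) | []=⇒lookup u∈ = _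

distinct-∈⇒2≤∣p∣ : ∀ {n} {p : Subset n} {u w} → u ∈ p → w ∈ p → u ≢ w → 2 ≤ ∣ p ∣
distinct-∈⇒2≤∣p∣ {p = p} {u} {w} u∈p w∈p u≢w = subst (_< ∣ p ∣) (∣⁅x⁆∣≡1 u)
  (p⊂q⇒∣p∣<∣q∣ (⁅u⁆⊆p , w , w∈p , u≢w ∘ sym ∘ x∈⁅y⁆⇒x≡y u))
  where
    ⁅u⁆⊆p : ∀ {x} → x ∈ ⁅ u ⁆ → x ∈ p
    ⁅u⁆⊆p x∈⁅u⁆ = subst (_∈ p) (sym (x∈⁅y⁆⇒x≡y u x∈⁅u⁆)) u∈p

module _ {n : ℕ} where

  UniqueMaxOn : Hypergraph n → VertexSet n → (Fin n → ℕ) → Set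
  UniqueMaxOn H U C = ∀ S → Edge H S → ∀ {x} → x ∈ S → T (U x) →
    Σ (Fin n) λ v → v ∈ S × T (U v) × (∀ u → u ∈ S → T (U u) → u ≢ v → C u < C v)

  FromListsAbove : ListAssignment n → ℕ → VertexSet n → (Fin n → ℕ) → Set
  FromListsAbove L t U C = ∀ v → T (U v) → C v ∈ˡ L v × t < C v

  IndependentIn : Hypergraph n → VertexSet n → VertexSet n → Set
  IndependentIn H U I = ∀ S → Edge H S → (∀ u → u ∈ S → T (U u) → T (I u)) →
    ∀ {u w} → u ∈ S → w ∈ S → T (U u) → T (U w) → u ≡ w

  paint : VertexSet n → ℕ → (Fin n → ℕ) → Fin n → ℕ
  paint I α C v = if I v then α else C v

  paint-inside : ∀ I α C {v} → T (I v) → paint I α C v ≡ α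
  paint-inside I α C {v} Iv with I v
  ... | true = refl

  paint-outside : ∀ I α C {v} → ¬ T (I v) → paint I α C v ≡ C v
  paint-outside I α C {v} ¬Iv with I v
  ... | true  = contradiction _ ¬Iv
  ... | false = refl

  fromListsAbove-paint : ∀ {L t α U I C} → t < α → (∀ v → T (I v) → α ∈ˡ L v) →
    FromListsAbove L α (U ∖ I) C → FromListsAbove L t U (paint I α C)
  fromListsAbove-paint {L} {t} {α} {I = I} {C} t<α α∈L C-ok v Uv with T? (I v)
  ... | yes Iv  = subst (λ c → c ∈ˡ L v × t < c) (sym (paint-inside I α C Iv)) (α∈L v Iv , t<α)
  ... | no ¬Iv = let (C∈L , α<C) = C-ok v (∖-intro Uv ¬Iv) in
    subst (λ c → c ∈ˡ L v × t < c) (sym (paint-outside I α C ¬Iv)) (C∈L , <-trans t<α α<C)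

  uniqueMaxOn-paint : ∀ {H U I α C} → IndependentIn H U I →
    (∀ v → T ((U ∖ I) v) → α < C v) →
    UniqueMaxOn H (U ∖ I) C → UniqueMaxOn H U (paint I α C)
  uniqueMaxOn-paint {U = U} {I} {α} {C} indep above uniq S e {x} x∈S Ux
    with any? (λ v → (v ∈? S) ×-dec T? ((U ∖ I) v))
  ... | yes (y , y∈S , [U∖I]y) with uniq S e y∈S [U∖I]y
  ...   | v , v∈S , [U∖I]v , C-below =
    let (Uv , ¬Iv) = ∖-elim [U∖I]v in
    v , v∈S , Uv , λ u u∈S Uu u≢v →
      subst (paint I α C u <_) (sym (paint-outside I α C ¬Iv)) (painted-below u u∈S Uu u≢v)
    where
      painted-below : ∀ u → u ∈ S → T (U u) → u ≢ v → paint I α C u < C v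
      painted-below u u∈S Uu u≢v with T? (I u)
      ... | yes Iu  = subst (_< C v) (sym (paint-inside I α C Iu)) (above v [U∖I]v)
      ... | no ¬Iu = subst (_< C v) (sym (paint-outside I α C ¬Iu))
                           (C-below u u∈S (∖-intro Uu ¬Iu) u≢v)
  uniqueMaxOn-paint {U = U} {I} indep _ _ S e {x} x∈S Ux | no none =
    x , x∈S , Ux , λ u u∈S Uu u≢x → contradiction (indep S e inI u∈S x∈S Uu Ux) u≢x
    where
      inI : ∀ u → u ∈ S → T (U u) → T (I u)
      inI u u∈S Uu = decidable-stable (T? (I u)) (λ ¬Iu → none (u , u∈S , ∖-intro Uu ¬Iu))

  properOn-constant⇒≡ : ∀ {k H V' S} {c : Fin n → Fin k} {j} →
    ProperOn H V' c → Edge H S → (∀ x → x ∈ S ∩ V' → c x ≡ j) →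
    ∀ {u w} → u ∈ S ∩ V' → w ∈ S ∩ V' → u ≡ w
  properOn-constant⇒≡ {S = S} proper e constant {u} {w} u∈ w∈ =
    decidable-stable (u Fin.≟ w) λ u≢w →
      let (a , b , a∈ , b∈ , ca≢cb) = proper S e (distinct-∈⇒2≤∣p∣ u∈ w∈ u≢w)
      in ca≢cb (trans (constant a a∈) (sym (constant b b∈)))

  colorClass : ∀ {k} → VertexSet n → (Fin n → Fin k) → Fin k → VertexSet n
  colorClass W c j v = W v ∧ does (c v Fin.≟ j)

  colorClass-⊆ : ∀ {k} W (c : Fin n → Fin k) j v → T (colorClass W c j v) → T (W v)
  colorClass-⊆ W c j v = proj₁ ∘ ∧-elim {W v}

  colorClass-independent : ∀ {k H U W} {c : Fin n → Fin k} → (∀ v → T (W v) → T (U v)) →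
    ProperOn H (tabulate W) c → ∀ j → IndependentIn H U (colorClass W c j)
  colorClass-independent {H = H} {U} {W} {c} W⊆U proper j S e inClass u∈S w∈S Uu Uw =
    properOn-constant⇒≡ {H = H} proper e constant (inS∩W u∈S Uu) (inS∩W w∈S Uw)
    where
      inS∩W : ∀ {x} → x ∈ S → T (U x) → x ∈ S ∩ tabulate W
      inS∩W {x} x∈S Ux =
        x∈p∩q⁺ (x∈S , ∈-tabulate⁺ (colorClass-⊆ W c j x (inClass x x∈S Ux)))
      constant : ∀ x → x ∈ S ∩ tabulate W → c x ≡ j
      constant x x∈ =
        let (x∈S , x∈W) = x∈p∩q⁻ S (tabulate W) x∈
        in T-does⁻ (c x Fin.≟ j)
             (proj₂ (∧-elim {W x} (inClass x x∈S (W⊆U x (∈-tabulate⁻ x∈W)))))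

  uniqueMaxOn-everywhere⇒UniqueMax : ∀ {H C} →
    UniqueMaxOn H (λ _ → true) C → UniqueMax H C
  uniqueMaxOn-everywhere⇒UniqueMax {H} uniq S e =
    let (x , x∈S) = nonempty H S e
        (v , v∈S , _ , below) = uniq S e x∈S _
    in v , v∈S , λ u u∈S → below u u∈S _

module Greedy {n} (H : Hypergraph n) (L : ListAssignment n) (d : ℕ) .{{_ : NonZero d}} (M : ℕ)
  (unique : ∀ v → Unique (L v)) (short : ∀ v → length (L v) ≤ M)
  (colorable : HereditarilyColorable (suc d) H) where

  open Potential d M public

  Φ : ℕ → VertexSet n → ℕ
  Φ t U = sum (λ v → potential t (L v) when U v)

  ColorableAbove : ℕ → Set
  ColorableAbove t = ∀ U → Φ t U < suc d ^ M →
    ∃ λ C → FromListsAbove L t U C × UniqueMaxOn H U C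

  holding : ℕ → VertexSet n → VertexSet n
  holding α U v = U v ∧ does (α ∈ˡ? L v)

  holding-⊆ : ∀ {α U} v → T (holding α U v) → T (U v)
  holding-⊆ {U = U} v = proj₁ ∘ ∧-elim {U v}

  holding-∈ : ∀ {α U} v → T (holding α U v) → α ∈ˡ L v
  holding-∈ {α} {U} v = T-does⁻ (α ∈ˡ? L v) ∘ proj₂ ∘ ∧-elim {U v}

  Φ-classes : ∀ {k} t W (c : Fin n → Fin k) → sum (λ i → Φ t (colorClass W c i)) ≡ Φ t W
  Φ-classes t W c = trans (∑-comm λ i v → potential t (L v) when colorClass W c i v)
                          (sum-cong-≗ λ v → ∑-when-≟ (c v) (W v) (potential t (L v)))

  Φ-accounting : ∀ t U (c : Fin n → Fin (suc d)) j →
    let W = holding (suc t) U ; I = colorClass W c j in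
    d * Φ (suc t) (U ∖ I) + suc d * Φ t I ≡ d * Φ t U + Φ t W
  Φ-accounting t U c j = begin
    d * Φ (suc t) (U ∖ I) + suc d * Φ t I
      ≡⟨ cong (d * Φ (suc t) (U ∖ I) +_) (*-distribˡ-sum (suc d) (λ v → p v when I v)) ⟩
    d * Φ (suc t) (U ∖ I) + sum (λ v → suc d * (p v when I v))
      ≡⟨ ∑-*-+ d (λ v → p⁺ v when (U ∖ I) v) (λ v → suc d * (p v when I v)) ⟨
    sum (λ v → d * (p⁺ v when (U ∖ I) v) + suc d * (p v when I v))
      ≡⟨ sum-cong-≗ perVertex ⟩
    sum (λ v → d * (p v when U v) + p v when W v)
      ≡⟨ ∑-*-+ d (λ v → p v when U v) (λ v → p v when W v) ⟩
    d * Φ t U + Φ t W ∎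
    where
      open ≡-Reasoning
      W = holding (suc t) U
      I = colorClass W c j
      p p⁺ : Fin n → ℕ
      p  v = potential t (L v)
      p⁺ v = potential (suc t) (L v)
      perVertex : ∀ v → d * (p⁺ v when (U ∖ I) v) + suc d * (p v when I v)
                      ≡ d * (p v when U v) + p v when W v
      perVertex v = when-accounting (U v) (does (suc t ∈ˡ? L v)) (does (c v Fin.≟ j))
        (λ ¬held → potential-∉ t (L v) (¬T-does⁻ (suc t ∈ˡ? L v) ¬held))
        (λ held → potential-∈ t (L v) (unique v) (short v) (T-does⁻ (suc t ∈ˡ? L v) held))

  Φ-heaviestClass : ∀ t U (c : Fin n → Fin (suc d)) j →
    let W = holding (suc t) U in
    (∀ i → Φ t (colorClass W c i) ≤ Φ t (colorClass W c j)) →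
    Φ (suc t) (U ∖ colorClass W c j) ≤ Φ t U
  Φ-heaviestClass t U c j heaviest = *-cancelˡ-≤ d (+-cancelʳ-≤ (suc d * Φ t I) _ _ (begin
    d * Φ (suc t) (U ∖ I) + suc d * Φ t I   ≡⟨ Φ-accounting t U c j ⟩
    d * Φ t U + Φ t W                        ≤⟨ +-monoʳ-≤ (d * Φ t U) W-share ⟩
    d * Φ t U + suc d * Φ t I                ∎))
    where
      open ≤-Reasoning
      W = holding (suc t) U
      I = colorClass W c j
      W-share : Φ t W ≤ suc d * Φ t I
      W-share = begin
        Φ t W                                        ≡⟨ Φ-classes t W c ⟨
        sum (λ i → Φ t (colorClass W c i))           ≤⟨ ∑-mono-≤ heaviest ⟩
        sum {suc d} (λ _ → Φ t I)                    ≡⟨ ∑-const (suc d) (Φ t I) ⟩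
        suc d * Φ t I                                ∎

  round : ∀ t → ColorableAbove (suc t) → ColorableAbove t
  round t next U Φ<K^M =
    let (C , C-lists , C-uniq) =
          next (U ∖ I) (≤-<-trans (Φ-heaviestClass t U c j heaviest) Φ<K^M)
    in paint I (suc t) C ,
       fromListsAbove-paint {U = U} {I} ≤-refl
         (λ v → holding-∈ {U = U} v ∘ colorClass-⊆ W c j v) C-lists ,
       uniqueMaxOn-paint {H = H} (colorClass-independent {H = H} holding-⊆ proper j)
                         (λ v → proj₂ ∘ C-lists v) C-uniq
    where
      W = holding (suc t) U
      c = proj₁ (colorable (tabulate W))
      proper = proj₂ (colorable (tabulate W))
      classPotential : Fin (suc d) → ℕ
      classPotential i = Φ t (colorClass W c i)
      j = argmax classPotential zero (allFin (suc d))
      heaviest : ∀ i → classPotential i ≤ classPotential j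
      heaviest i =
        All.lookup (f[xs]≤f[argmax] {f = classPotential} zero (allFin (suc d))) (∈-allFin i)
      I = colorClass W c j

  colorableAbove-exhausted : ∀ t → (∀ v → All (_≤ t) (L v)) → ColorableAbove t
  colorableAbove-exhausted t exhausted U Φ<K^M =
    (λ _ → 0) ,
    (λ v Uv → contradiction Uv (uncolored v)) ,
    (λ S e x∈S Ux → contradiction Ux (uncolored _))
    where
      uncolored : ∀ v → ¬ T (U v)
      uncolored v Uv = <⇒≱ Φ<K^M (begin
        suc d ^ M                          ≡⟨ potential-exhausted t (L v) (exhausted v) ⟨
        potential t (L v)                  ≡⟨ when-true (potential t (L v)) Uv ⟨
        potential t (L v) when U v         ≤⟨ ≤-∑ (λ v → potential t (L v) when U v) v ⟩
        Φ t U                              ∎)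
        where open ≤-Reasoning

mainTheorem5 : (k n : ℕ) → 2 ≤ k → (H : Hypergraph n) → HereditarilyColorable k H →
    (L : ListAssignment n) → WellFormedLists L →
    (∀ v → GtLog k n (length (L v))) →
    ∃ λ (C : Fin n → ℕ) → FromLists L C × UniqueMax H C
mainTheorem5 (suc (suc k')) n (s≤s (s≤s z≤n)) H colorable L wellFormed gtLog =
  let (C , C-lists , C-uniq) = colorableAbove-0 (λ _ → true) Φ<K^M
  in C , (λ v → proj₁ (C-lists v _)) , uniqueMaxOn-everywhere⇒UniqueMax {H = H} C-uniq
  where
    M = sum (λ v → length (L v))
    B = sum (λ v → max 0 (L v))
    open Greedy H L (suc k') M (proj₁ ∘ wellFormed) (≤-∑ (λ v → length (L v))) colorable
    colorableAbove-0 : ColorableAbove 0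
    colorableAbove-0 = descend round B (colorableAbove-exhausted B λ v →
      All.map (λ x≤max → ≤-trans x≤max (≤-∑ (λ v → max 0 (L v)) v)) (xs≤max 0 (L v)))
    Φ<K^M : Φ 0 (λ _ → true) < suc (suc k') ^ M
    Φ<K^M = ∀[m*f<X]⇒∑f<X _ (m^n>0 (suc (suc k')) M) λ v →
      potential-initial n (L v) (proj₂ (wellFormed v)) (≤-∑ (λ v → length (L v)) v) (gtLog v)
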